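{- Let $\Sigma=\{\mathtt{a},\mathtt{b}\}$, $k\in\mathbb{N}$, and $w,w'\in\Sigma^*$ with $w\sim_k w'$ and $m\coloneqq\iota(w)=\iota(w')<k$, with $\alpha$-$\beta$-factorizations $w=\alpha_0\beta_1\alpha_1\cdots\beta_m\alpha_m$ and $w'=\alpha_0'\beta_1'\alpha_1'\cdots\beta_m'\alpha_m'$. Then $\mathrm{m}(w)=\mathrm{m}(w')$, and $\beta_i=\beta_i'$ for all $i\in\{1,\dots,m\}$.
   Context: A word $u$ is a scattered factor of $w$ if $u$ is obtained from $w$ by deleting some letters (keeping order). For $k\in\mathbb{N}_0$, $u\sim_k v$ iff $u$ and $v$ have exactly the same scattered factors of length at most $k$. $\iota(w)$ is the largest $\ell$ such that every word of $\Sigma^\ell$ is a scattered factor of $w$. The arch factorization of $w$ is the unique factorization $w=\mathrm{ar}_1(w)\cdots\mathrm{ar}_\ell(w)\mathrm{re}(w)$ where each arch contains every letter of $\Sigma$ and its last letter occurs exactly once in it, and $\mathrm{re}(w)$ does not contain every letter of $\Sigma$; $\ell=\iota(w)$. The modus $\mathrm{m}(w)$ is the word formed by the last letters of the arches. With $w^R$ the reversal, $\mathrm{ra}_i(w)\coloneqq(\mathrm{ar}_{\iota(w)-i+1}(w^R))^R$ and $\mathrm{er}(w)\coloneqq(\mathrm{re}(w^R))^R$. The $\alpha$-$\beta$-factorization is $w=\alpha_0\beta_1\alpha_1\cdots\beta_{\iota(w)}\alpha_{\iota(w)}$ with $\mathrm{ar}_i(w)=\alpha_{i-1}\beta_i$,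 $\mathrm{ra}_i(w)=\beta_i\alpha_i$ for $i\in\{1,\dots,\iota(w)\}$, $\alpha_0=\mathrm{er}(w)$, $\alpha_{\iota(w)}=\mathrm{re}(w)$. -}

module Defs where

open import Data.Nat using (ℕ; _≤_)
open import Data.List using (List; []; _∷_; _++_; [_]; concat; map; reverse; length; last)
open import Data.List.Membership.Propositional using (_∈_; _∉_)
open import Data.List.Relation.Unary.All using (All)
open import Data.List.Relation.Binary.Sublist.Propositional using (_⊆_)
open import Data.Maybe using (Maybe)
open import Data.Product using (Σ; ∃; ∃-syntax; _×_; _,_; proj₁; proj₂)
open import Relation.Nullary using (¬_)
open import Relation.Binary.PropositionalEquality using (_≡_)

data Letter : Set where
  a b : Letter

Word : Set
Word = List Letter

ScatteredFactor : Word → Word → Set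
ScatteredFactor u w = u ⊆ w

_∼[_]_ : Word → ℕ → Word → Set
u ∼[ k ] v = ∀ (x : Word) → length x ≤ k →
  (ScatteredFactor x u → ScatteredFactor x v) × (ScatteredFactor x v → ScatteredFactor x u)

Universal : ℕ → Word → Set
Universal ℓ w = ∀ (u : Word) → length u ≡ ℓ → ScatteredFactor u w

IsIota : Word → ℕ → Set
IsIota w ℓ = Universal ℓ w × (∀ ℓ' → Universal ℓ' w → ℓ' ≤ ℓ)

ContainsAll : Word → Set
ContainsAll u = ∀ (x : Letter) → x ∈ u

IsArch : Word → Set
IsArch u = ContainsAll u × (Σ Word λ v → Σ Letter λ x → (u ≡ v ++ [ x ]) × (x ∉ v))

ArchFact : Word → List Word → Word → Set
ArchFact w arches rest = (w ≡ concat arches ++ rest) × All IsArch arches × ¬ ContainsAll rest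

-- modus: the word of the last letters of the arches
-- (each arch is nonempty, so every entry is a 'just')
modusOf : List Word → List (Maybe Letter)
modusOf arches = map last arches

-- α-β-factorization, represented by α₀ and the list of pairs (β_i , α_i), i = 1..ι(w).
abWord : Word → List (Word × Word) → Word
abWord α₀ [] = α₀
abWord α₀ ((β , α) ∷ ps) = α₀ ++ β ++ abWord α ps

abArches : Word → List (Word × Word) → List Word
abArches α₀ [] = []
abArches α₀ ((β , α) ∷ ps) = (α₀ ++ β) ∷ abArches α ps

abLast : Word → List (Word × Word) → Word
abLast α₀ [] = α₀
abLast α₀ ((β , α) ∷ ps) = abLast α ps

abRa : List (Word × Word) → List Word
abRa ps = map (λ p → proj₁ p ++ proj₂ p) ps

-- w = α₀ β₁ α₁ ⋯ β_ι α_ι is the α-β-factorization of w: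
--  ar_i(w) = α_{i-1} β_i, re(w) = α_ι (arch factorization of w), and
--  ra_i(w) = (ar_{ι-i+1}(w^R))^R = β_i α_i, er(w) = (re(w^R))^R = α₀.
IsABFact : Word → Word → List (Word × Word) → Set
IsABFact w α₀ ps =
  (w ≡ abWord α₀ ps)
  × ArchFact w (abArches α₀ ps) (abLast α₀ ps)
  × (Σ (List Word) λ archesR → Σ Word λ restR →
       ArchFact (reverse w) archesR restR
       × (map reverse (reverse archesR) ≡ abRa ps)
       × (reverse restR ≡ α₀))

module Submission where

-- Over {a, b} an arch is x⋯x y with y ≢ x, so the modus and ι are computed greedily.
-- A word of length ι(w) + 1 missing from w is short enough to be seen by ∼_k, so
-- ∼_k preserves ι below k.  By induction on ι, two ∼_k-equivalent words with ι < k
-- start with the same letter (otherwise cancelling letters leaves t ∼ x t' and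
-- t' ∼ y t, which a second induction rules out), hence with the same first arch, and
-- cancelling that arch lowers both k and ι by one: the modi agree.  Applied to w^R
-- this fixes the first letters of the ra_i, and β_i, a suffix of ar_i and a prefix of
-- ra_i, is pinned down by the last letter y of ar_i and the first letter z of ra_i:
-- it is y or z y.

open import Defs
open import Data.Nat using (ℕ; zero; suc; _<_; _≤_; _∸_; _+_; s≤s; z≤n)
open import Data.Nat.Properties using (1+n≢n; ≤-antisym; ≤-refl; ≤-reflexive; ≤-trans; <⇒≤; <-irrefl; ≮⇒≥; m+[n∸m]≡n; suc-injective)
open import Data.List using (List; []; _∷_; _++_; [_]; map; length; reverse; concat; replicate; zipWith; head; last; initLast; _∷ʳ′_)
open import Data.List.Properties using (++-assoc; ++-identityʳ; ∷ʳ-++; ∷ʳ-injective; length-++; length-replicate; length-reverse; reverse-++; reverse-involutive; reverse-map; map-∘; map-cong)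
open import Data.List.Membership.Propositional using (_∈_; _∉_)
open import Data.List.Relation.Unary.Any using (here; there)
import Data.List.Relation.Unary.Any.Properties as Any
open import Data.List.Relation.Unary.All as All using (All; []; _∷_)
import Data.List.Relation.Unary.All.Properties as All
open import Data.List.Relation.Binary.Sublist.Propositional using (_⊆_; _⊈_; _∷_; _∷ʳ_; ⊆-refl; ⊆-trans; to∈; from∈)
open import Data.List.Relation.Binary.Sublist.Propositional.Properties using (∷⁻; ∷ʳ⁻; ++⁺ˡ; ++⁺ʳ; []⊆-universal; reverse⁺; reverse⁻)
open import Data.Maybe using (Maybe; just)
open import Data.Product using (∃-syntax; ∃₂; _×_; _,_; proj₁; proj₂)
open import Data.Empty using (⊥; ⊥-elim)
open import Function using (_∘_)
open import Relation.Nullary using (¬_; Dec; yes; no)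
open import Relation.Binary.PropositionalEquality using (_≡_; _≢_; refl; sym; trans; cong; cong₂; subst; ≢-sym; module ≡-Reasoning)

_≟_ : (x y : Letter) → Dec (x ≡ y)
a ≟ a = yes refl
a ≟ b = no λ ()
b ≟ a = no λ ()
b ≟ b = yes refl

other : Letter → Letter
other a = b
other b = a

≢-other : ∀ x → x ≢ other x
≢-other a ()
≢-other b ()

≢⇒≡ : ∀ {x y z : Letter} → x ≢ y → z ≢ x → z ≡ y
≢⇒≡ {a} {a} x≢y _ = ⊥-elim (x≢y refl)
≢⇒≡ {b} {b} x≢y _ = ⊥-elim (x≢y refl)
≢⇒≡ {a} {b} {a} _ z≢x = ⊥-elim (z≢x refl)
≢⇒≡ {a} {b} {b} _ _ = refl
≢⇒≡ {b} {a} {a} _ _ = refl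
≢⇒≡ {b} {a} {b} _ z≢x = ⊥-elim (z≢x refl)

∉-∷⁺ : ∀ {x y : Letter} {v} → y ≢ x → y ∉ v → y ∉ x ∷ v
∉-∷⁺ y≢x _ (here y≡x) = y≢x y≡x
∉-∷⁺ _ y∉v (there y∈v) = y∉v y∈v

mutual
  modus : Word → List (Maybe Letter)
  modus [] = []
  modus (x ∷ w) = modusAfter x w

  -- modusAfter x w = modus (x ∷ w): over {a, b} the first arch ends at the first letter other than x.
  modusAfter : Letter → Word → List (Maybe Letter)
  modusAfter x [] = []
  modusAfter a (a ∷ w) = modusAfter a w
  modusAfter a (b ∷ w) = just b ∷ modus w
  modusAfter b (a ∷ w) = just a ∷ modus w
  modusAfter b (b ∷ w) = modusAfter b w

ι : Word → ℕ
ι w = length (modus w)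

modus-arch : ∀ {x y} v t → x ≢ y → y ∉ v → modus (x ∷ v ++ y ∷ t) ≡ just y ∷ modus t
modus-arch {a} {a} _ _ x≢y _ = ⊥-elim (x≢y refl)
modus-arch {b} {b} _ _ x≢y _ = ⊥-elim (x≢y refl)
modus-arch {a} {b} [] t _ _ = refl
modus-arch {b} {a} [] t _ _ = refl
modus-arch {a} {b} (a ∷ v) t x≢y y∉ = modus-arch v t x≢y (y∉ ∘ there)
modus-arch {a} {b} (b ∷ v) t _ y∉ = ⊥-elim (y∉ (here refl))
modus-arch {b} {a} (a ∷ v) t _ y∉ = ⊥-elim (y∉ (here refl))
modus-arch {b} {a} (b ∷ v) t x≢y y∉ = modus-arch v t x≢y (y∉ ∘ there)

ι-arch : ∀ {x y n} v t → x ≢ y → y ∉ v → ι t ≡ n → ι (x ∷ v ++ y ∷ t) ≡ suc n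
ι-arch v t x≢y y∉v refl = cong length (modus-arch v t x≢y y∉v)

data FirstArch (n : ℕ) : Word → Set where
  arch : ∀ {x y} v t → x ≢ y → y ∉ v → ι t ≡ n → FirstArch n (x ∷ v ++ y ∷ t)

FirstArch-∷ : ∀ {n x w} → FirstArch n (x ∷ w) → FirstArch n (x ∷ x ∷ w)
FirstArch-∷ (arch v t x≢y y∉v ιt) = arch (_ ∷ v) t x≢y (∉-∷⁺ (≢-sym x≢y) y∉v) ιt

first-arch-after : ∀ x w {n} → length (modusAfter x w) ≡ suc n → FirstArch n (x ∷ w)
first-arch-after a (a ∷ w) ι≡ = FirstArch-∷ (first-arch-after a w ι≡)
first-arch-after a (b ∷ w) ι≡ = arch [] w (λ ()) (λ ()) (suc-injective ι≡)
first-arch-after b (a ∷ w) ι≡ = arch [] w (λ ()) (λ ()) (suc-injective ι≡)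
first-arch-after b (b ∷ w) ι≡ = FirstArch-∷ (first-arch-after b w ι≡)

first-arch : ∀ w {n} → ι w ≡ suc n → FirstArch n w
first-arch (x ∷ w) = first-arch-after x w

FirstArch⇒ContainsAll : ∀ {n w} → FirstArch n w → ContainsAll w
FirstArch⇒ContainsAll (arch {x} {y} v t x≢y _ _) c with c ≟ x
... | yes refl = here refl
... | no c≢x with refl ← ≢⇒≡ x≢y c≢x = there (Any.++⁺ʳ v (here refl))

modus-incomplete : ∀ w → ¬ ContainsAll w → modus w ≡ []
modus-incomplete w ¬all with modus w in eq
... | [] = refl
... | _ ∷ _ = ⊥-elim (¬all (FirstArch⇒ContainsAll (first-arch w (cong length eq))))

other∉ : ∀ x w → length (modusAfter x w) ≡ 0 → other x ∉ x ∷ w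
other∉ x w _ (here other≡x) = ≢-other x (sym other≡x)
other∉ a (a ∷ w) ι≡ (there b∈) = other∉ a w ι≡ b∈
other∉ b (b ∷ w) ι≡ (there a∈) = other∉ b w ι≡ a∈

ι≡0⇒∉ : ∀ w → ι w ≡ 0 → ∃[ c ] c ∉ w
ι≡0⇒∉ [] _ = a , λ ()
ι≡0⇒∉ (x ∷ w) ι≡ = other x , other∉ x w ι≡

∷⊆-cancel : ∀ {c : Letter} {u t : Word} v → c ∉ v → (c ∷ u) ⊆ (v ++ c ∷ t) → u ⊆ t
∷⊆-cancel [] _ p = ∷⁻ p
∷⊆-cancel (d ∷ v) c∉ p = ∷⊆-cancel v (c∉ ∘ there) (∷ʳ⁻ (c∉ ∘ here) p)

∼-sym : ∀ {k w w'} → w ∼[ k ] w' → w' ∼[ k ] w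
∼-sym w∼w' u ∣u∣≤k = proj₂ (w∼w' u ∣u∣≤k) , proj₁ (w∼w' u ∣u∣≤k)

∼-cancel : ∀ {k} {c : Letter} {t t' : Word} v v' → c ∉ v → c ∉ v' → (v ++ c ∷ t) ∼[ suc k ] (v' ++ c ∷ t') → t ∼[ k ] t'
∼-cancel v v' c∉v c∉v' e u ∣u∣≤k =
  (λ u⊆t → ∷⊆-cancel v' c∉v' (proj₁ (e (_ ∷ u) (s≤s ∣u∣≤k)) (++⁺ˡ v (refl ∷ u⊆t)))) ,
  (λ u⊆t' → ∷⊆-cancel v c∉v (proj₂ (e (_ ∷ u) (s≤s ∣u∣≤k)) (++⁺ˡ v' (refl ∷ u⊆t'))))

∈-∼ : ∀ {k w w'} {c : Letter} → 0 < k → w ∼[ k ] w' → c ∈ w → c ∈ w'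
∈-∼ (s≤s _) e c∈w = to∈ (proj₁ (e [ _ ] (s≤s z≤n)) (from∈ c∈w))

≤ι⇒⊆ : ∀ u w → length u ≤ ι w → u ⊆ w
≤ι⇒⊆ [] w _ = []⊆-universal w
≤ι⇒⊆ (c ∷ u) w ∣cu∣≤ι with ι w in ι≡
≤ι⇒⊆ (c ∷ u) w (s≤s ∣u∣≤n) | suc n with first-arch w ι≡
... | arch {x} {y} v t x≢y y∉v ιt with c ≟ y | ≤ι⇒⊆ u t (≤-trans ∣u∣≤n (≤-reflexive (sym ιt)))
...   | yes refl | u⊆t = ++⁺ˡ (x ∷ v) (refl ∷ u⊆t)
...   | no c≢y   | u⊆t = ≢⇒≡ (≢-sym x≢y) c≢y ∷ ++⁺ˡ v (y ∷ʳ u⊆t)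

missing-factor : ∀ n w → ι w ≡ n → ∃[ u ] length u ≡ suc n × u ⊈ w
missing-factor zero w ι≡ with ι≡0⇒∉ w ι≡
... | c , c∉w = [ c ] , refl , c∉w ∘ to∈
missing-factor (suc n) w ι≡ with first-arch w ι≡
... | arch {x} {y} v t x≢y y∉v ιt with missing-factor n t ιt
...   | u , ∣u∣ , u⊈t = y ∷ u , cong suc ∣u∣ , u⊈t ∘ ∷⊆-cancel (x ∷ v) (∉-∷⁺ (≢-sym x≢y) y∉v)

universal-≤ : ∀ {m n w} → n ≤ m → Universal m w → Universal n w
universal-≤ {m} {n} n≤m U u ∣u∣ = ⊆-trans (++⁺ʳ padding ⊆-refl) (U (u ++ padding) ∣u++padding∣)
  where
  padding = replicate (m ∸ n) a
  open ≡-Reasoning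
  ∣u++padding∣ : length (u ++ padding) ≡ m
  ∣u++padding∣ = begin
    length (u ++ padding)             ≡⟨ length-++ u ⟩
    length u + length padding         ≡⟨ cong₂ _+_ ∣u∣ (length-replicate (m ∸ n)) ⟩
    n + (m ∸ n)                       ≡⟨ m+[n∸m]≡n n≤m ⟩
    m                                 ∎

≤ι⇒universal : ∀ {m w} → m ≤ ι w → Universal m w
≤ι⇒universal m≤ι u refl = ≤ι⇒⊆ u _ m≤ι

universal⇒≤ι : ∀ {m w} → Universal m w → m ≤ ι w
universal⇒≤ι {m} {w} U = ≮⇒≥ λ ι<m →
  let u , ∣u∣ , u⊈w = missing-factor (ι w) w refl in u⊈w (universal-≤ ι<m U u ∣u∣)

isIota⇒≡ι : ∀ {w m} → IsIota w m → m ≡ ι w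
isIota⇒≡ι (U , maximal) = ≤-antisym (universal⇒≤ι U) (maximal _ (≤ι⇒universal ≤-refl))

universal-∼ : ∀ {m k w w'} → m ≤ k → w ∼[ k ] w' → Universal m w → Universal m w'
universal-∼ m≤k w∼w' U u refl = proj₁ (w∼w' u m≤k) (U u refl)

ι-∼ : ∀ {k w w'} → ι w < k → w ∼[ k ] w' → ι w' ≡ ι w
ι-∼ ι<k w∼w' = ≤-antisym
  (≮⇒≥ λ ι<ι' → <-irrefl refl
    (universal⇒≤ι (universal-∼ ι<k (∼-sym w∼w') (≤ι⇒universal ι<ι'))))
  (universal⇒≤ι (universal-∼ (<⇒≤ ι<k) w∼w' (≤ι⇒universal ≤-refl)))

¬∼-ι-suc : ∀ {n k w w'} → ι w ≡ n → ι w' ≡ suc n → n < k → ¬ w ∼[ k ] w'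
¬∼-ι-suc refl ι'≡ ι<k w∼w' = 1+n≢n (trans (sym ι'≡) (ι-∼ ι<k w∼w'))

-- After cancelling the first letters, w = x y t ∼ w' = y x t' leaves t ∼ x t' and t' ∼ y t.
NoCrossing : ℕ → Set
NoCrossing n = ∀ {k x y t t'} → x ≢ y → ι t ≡ n → ι t' ≡ n → n < k →
  t ∼[ k ] (x ∷ t') → t' ∼[ k ] (y ∷ t) → ⊥

¬crossed-arches : ∀ {n k x y t t'} → NoCrossing n → x ≢ y → ∀ v v' → y ∉ v → x ∉ v' →
  ι t ≡ n → ι t' ≡ n → suc n < k → ¬ (x ∷ v ++ y ∷ t) ∼[ k ] (y ∷ v' ++ x ∷ t')
¬crossed-arches {k = suc k} no× x≢y [] [] _ _ ιt ιt' (s≤s n<k) w∼w' =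
  no× x≢y ιt ιt' n<k
    (∼-cancel [ _ ] [] (∉-∷⁺ (≢-sym x≢y) (λ ())) (λ ()) w∼w')
    (∼-sym (∼-cancel [] [ _ ] (λ ()) (∉-∷⁺ x≢y (λ ())) w∼w'))
¬crossed-arches {k = suc k} no× x≢y v (y₁ ∷ v') y∉v x∉v' ιt ιt' (s≤s n<k) w∼w' =
  ¬∼-ι-suc ιt (ι-arch v' _ (x∉v' ∘ here ∘ sym) (x∉v' ∘ there) ιt') n<k
    (∼-cancel (_ ∷ v) [] (∉-∷⁺ (≢-sym x≢y) y∉v) (λ ()) w∼w')
¬crossed-arches {k = suc k} no× x≢y (x₁ ∷ v) [] y∉v x∉v' ιt ιt' (s≤s n<k) w∼w' =
  ¬∼-ι-suc ιt' (ι-arch v _ (y∉v ∘ here ∘ sym) (y∉v ∘ there) ιt) n<k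
    (∼-sym (∼-cancel [] [ _ ] (λ ()) (∉-∷⁺ x≢y (λ ())) w∼w'))

head-∼ : ∀ {n k w w'} → NoCrossing n → ι w ≡ suc n → ι w' ≡ suc n → suc n < k →
  w ∼[ k ] w' → head w ≡ head w'
head-∼ {w = w} {w'} no× ιw ιw' n<k w∼w' with first-arch w ιw | first-arch w' ιw'
... | arch {x} {y} v t x≢y y∉v ιt | arch {x'} v' t' x'≢y' y'∉v' ιt' with x ≟ x'
...   | yes refl = refl
...   | no x≢x' with refl ← ≢⇒≡ x≢y (≢-sym x≢x') with refl ← ≢⇒≡ (≢-sym x≢y) (≢-sym x'≢y') =
  ⊥-elim (¬crossed-arches no× x≢y v v' y∉v y'∉v' ιt ιt' n<k w∼w')

¬crossed-successors : ∀ {n k x y t t'} → NoCrossing n → x ≢ y → ∀ v v' → y ∉ v → x ∉ v' →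
  ι t ≡ n → ι t' ≡ n → suc n < k →
  (x ∷ v ++ y ∷ t) ∼[ k ] (x ∷ y ∷ v' ++ x ∷ t') → (y ∷ v' ++ x ∷ t') ∼[ k ] (y ∷ x ∷ v ++ y ∷ t) → ⊥
¬crossed-successors {k = suc k} no× x≢y [] [] _ _ ιt ιt' (s≤s n<k) e₁ e₂ =
  no× x≢y ιt ιt' n<k
    (∼-cancel [ _ ] [ _ ] (∉-∷⁺ (≢-sym x≢y) (λ ())) (∉-∷⁺ (≢-sym x≢y) (λ ())) e₁)
    (∼-cancel [ _ ] [ _ ] (∉-∷⁺ x≢y (λ ())) (∉-∷⁺ x≢y (λ ())) e₂)
¬crossed-successors no× x≢y (x₁ ∷ v) v' y∉v x∉v' ιt ιt' n<k e₁ e₂ =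
  ¬∼-ι-suc (ι-arch v' _ (≢-sym x≢y) x∉v' ιt')
    (ι-arch [] _ (≢-sym x≢y) (λ ()) (ι-arch v _ (y∉v ∘ here ∘ sym) (y∉v ∘ there) ιt))
    n<k e₂
¬crossed-successors no× x≢y [] (y₁ ∷ v') y∉v x∉v' ιt ιt' n<k e₁ e₂ =
  ¬∼-ι-suc (ι-arch [] _ x≢y (λ ()) ιt)
    (ι-arch [] _ x≢y (λ ()) (ι-arch v' _ (x∉v' ∘ here ∘ sym) (x∉v' ∘ there) ιt'))
    n<k e₁

noCrossing : ∀ n → NoCrossing n
noCrossing zero {x = x} {t = t} x≢y ιt _ 0<k e₁ e₂ with ι≡0⇒∉ t ιt
... | c , c∉t with c ≟ x
...   | yes refl = c∉t (∈-∼ 0<k (∼-sym e₁) (here refl))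
...   | no c≢x with refl ← ≢⇒≡ x≢y c≢x =
  c∉t (∈-∼ 0<k (∼-sym e₁) (there (∈-∼ 0<k (∼-sym e₂) (here refl))))
noCrossing (suc n) {k} {t = t} {t'} x≢y ιt ιt' n<k e₁ e₂
  with first-arch t ιt | first-arch t' ιt'
     | head-∼ (noCrossing n) ιt (trans (ι-∼ (subst (_< k) (sym ιt) n<k) e₁) ιt) n<k e₁
     | head-∼ (noCrossing n) ιt' (trans (ι-∼ (subst (_< k) (sym ιt') n<k) e₂) ιt') n<k e₂
... | arch {_} {y₀} v t₂ x≢y₀ y₀∉v ιt₂ | arch {_} {x₀} v' t₂' y≢x₀ x₀∉v' ιt₂' | refl | refl
  with refl ← ≢⇒≡ x≢y (≢-sym x≢y₀) | refl ← ≢⇒≡ (≢-sym x≢y) (≢-sym y≢x₀) =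
  ¬crossed-successors (noCrossing n) x≢y v v' y₀∉v x₀∉v' ιt₂ ιt₂' n<k e₁ e₂

modus≡[] : ∀ w → ι w ≡ 0 → modus w ≡ []
modus≡[] w ι≡ with modus w
... | [] = refl

modus-∼ : ∀ n {k w w'} → ι w ≡ n → ι w' ≡ n → n < k → w ∼[ k ] w' → modus w ≡ modus w'
modus-∼ zero {w = w} {w'} ιw ιw' _ _ = trans (modus≡[] w ιw) (sym (modus≡[] w' ιw'))
modus-∼ (suc n) {suc k} {w} {w'} ιw ιw' (s≤s n<k) w∼w'
  with first-arch w ιw | first-arch w' ιw' | head-∼ (noCrossing n) ιw ιw' (s≤s n<k) w∼w'
... | arch {x} {y} v t x≢y y∉v ιt | arch {_} {y'} v' t' x≢y' y'∉v' ιt' | refl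
  with refl ← ≢⇒≡ x≢y (≢-sym x≢y') = begin
    modus (x ∷ v ++ y ∷ t)    ≡⟨ modus-arch v t x≢y y∉v ⟩
    just y ∷ modus t          ≡⟨ cong (just y ∷_) (modus-∼ n ιt ιt' n<k (∼-cancel (x ∷ v) (x ∷ v') y∉xv y∉xv' w∼w')) ⟩
    just y ∷ modus t'         ≡⟨ modus-arch v' t' x≢y y'∉v' ⟨
    modus (x ∷ v' ++ y ∷ t')  ∎
  where
  open ≡-Reasoning
  y∉xv = ∉-∷⁺ (≢-sym x≢y) y∉v
  y∉xv' = ∉-∷⁺ (≢-sym x≢y) y'∉v'

⊆-reverseʳ : ∀ {u w : Word} → u ⊆ reverse w → reverse u ⊆ w
⊆-reverseʳ {u} u⊆wᴿ = reverse⁻ (subst (_⊆ _) (sym (reverse-involutive u)) u⊆wᴿ)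

⊆-reverseˡ : ∀ {u w : Word} → reverse u ⊆ w → u ⊆ reverse w
⊆-reverseˡ {u} uᴿ⊆w = subst (_⊆ _) (reverse-involutive u) (reverse⁺ uᴿ⊆w)

∼-reverse : ∀ {k w w'} → w ∼[ k ] w' → reverse w ∼[ k ] reverse w'
∼-reverse {k} w∼w' u ∣u∣≤k =
  (λ u⊆wᴿ → ⊆-reverseˡ (proj₁ (w∼w' (reverse u) ∣uᴿ∣≤k) (⊆-reverseʳ u⊆wᴿ))) ,
  (λ u⊆w'ᴿ → ⊆-reverseˡ (proj₂ (w∼w' (reverse u) ∣uᴿ∣≤k) (⊆-reverseʳ u⊆w'ᴿ)))
  where ∣uᴿ∣≤k = subst (_≤ k) (sym (length-reverse u)) ∣u∣≤k

universal-reverse : ∀ {m w} → Universal m w → Universal m (reverse w)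
universal-reverse U u ∣u∣ = ⊆-reverseˡ (U (reverse u) (trans (length-reverse u) ∣u∣))

ι≤ι-reverse : ∀ w → ι w ≤ ι (reverse w)
ι≤ι-reverse w = universal⇒≤ι (universal-reverse {w = w} (≤ι⇒universal ≤-refl))

ι-reverse : ∀ w → ι (reverse w) ≡ ι w
ι-reverse w = ≤-antisym
  (subst (λ v → ι (reverse w) ≤ ι v) (reverse-involutive w) (ι≤ι-reverse (reverse w)))
  (ι≤ι-reverse w)

last-∷ʳ : ∀ (v : Word) x → last (v ++ [ x ]) ≡ just x
last-∷ʳ [] x = refl
last-∷ʳ (y ∷ []) x = refl
last-∷ʳ (y ∷ z ∷ v) x = last-∷ʳ (z ∷ v) x

head-reverse : ∀ (u : Word) → head (reverse u) ≡ last u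
head-reverse u with initLast u
... | [] = refl
... | v ∷ʳ′ x rewrite reverse-++ v [ x ] = sym (last-∷ʳ v x)

modus-++-arch : ∀ r {u} → IsArch u → modus (u ++ r) ≡ last u ∷ modus r
modus-++-arch r (all , [] , x , refl , _) with all (other x)
... | here other≡x = ⊥-elim (≢-other x (sym other≡x))
modus-++-arch r (_ , y ∷ v , x , refl , x∉yv) = begin
  modus ((y ∷ v ++ [ x ]) ++ r)    ≡⟨ cong (modus ∘ (y ∷_)) (∷ʳ-++ v x r) ⟩
  modus (y ∷ v ++ x ∷ r)           ≡⟨ modus-arch v r (x∉yv ∘ here ∘ sym) (x∉yv ∘ there) ⟩
  just x ∷ modus r                 ≡⟨ cong (_∷ modus r) (last-∷ʳ (y ∷ v) x) ⟨
  last (y ∷ v ++ [ x ]) ∷ modus r  ∎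
  where open ≡-Reasoning

modusOf-concat : ∀ {ar} re → All IsArch ar → ¬ ContainsAll re → modusOf ar ≡ modus (concat ar ++ re)
modusOf-concat re [] ¬all = sym (modus-incomplete re ¬all)
modusOf-concat {u ∷ ar} re (u-arch ∷ arches) ¬all = begin
  last u ∷ modusOf ar               ≡⟨ cong (last u ∷_) (modusOf-concat re arches ¬all) ⟩
  last u ∷ modus (concat ar ++ re)  ≡⟨ modus-++-arch (concat ar ++ re) u-arch ⟨
  modus (u ++ concat ar ++ re)      ≡⟨ cong modus (++-assoc u (concat ar) re) ⟨
  modus ((u ++ concat ar) ++ re)    ∎
  where open ≡-Reasoning

modusOf-archFact : ∀ {w ar re} → ArchFact w ar re → modusOf ar ≡ modus w
modusOf-archFact (refl , arches , ¬all) = modusOf-concat _ arches ¬all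

-- The reversal of an arch of w^R, such as ra_i(w), begins with a letter that does not recur.
HeadUnique : Word → Set
HeadUnique u = ∃₂ λ z v → u ≡ z ∷ v × z ∉ v

reverse-arch : ∀ {u} → IsArch u → HeadUnique (reverse u)
reverse-arch (_ , v , x , refl , x∉v) = x , reverse v , reverse-++ v [ x ] , x∉v ∘ Any.reverse⁻

All-reverse⁺ : ∀ {P : Word → Set} {us} → All P us → All P (reverse us)
All-reverse⁺ ps = All.tabulate (All.lookup ps ∘ Any.reverse⁻)

ContainsAll-reverse⁻ : ∀ {u} → ContainsAll (reverse u) → ContainsAll u
ContainsAll-reverse⁻ all c = Any.reverse⁻ (all c)

-- β_i ends with y, the last letter of ar_i, and begins with z, the first letter of ra_i.
βOf : Maybe Letter → Maybe Letter → Word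
βOf (just a) (just a) = [ a ]
βOf (just b) (just b) = [ b ]
βOf (just y) (just z) = z ∷ y ∷ []
βOf _ _ = []

βOf-≡ : ∀ y → βOf (just y) (just y) ≡ [ y ]
βOf-≡ a = refl
βOf-≡ b = refl

βOf-≢ : ∀ {y z} → z ≢ y → βOf (just y) (just z) ≡ z ∷ y ∷ []
βOf-≢ {a} {a} z≢y = ⊥-elim (z≢y refl)
βOf-≢ {a} {b} _ = refl
βOf-≢ {b} {a} _ = refl
βOf-≢ {b} {b} z≢y = ⊥-elim (z≢y refl)

β-shape : ∀ {y α'} β → y ∉ β → HeadUnique ((β ++ [ y ]) ++ α') →
  β ++ [ y ] ≡ βOf (just y) (head ((β ++ [ y ]) ++ α')) × ¬ ContainsAll α'
β-shape [] _ (z , _ , refl , z∉α') = sym (βOf-≡ z) , λ all → z∉α' (all z)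
β-shape (c ∷ []) y∉c (_ , _ , refl , c∉) = sym (βOf-≢ (c∉ ∘ here)) , λ all → c∉ (there (all c))
β-shape (c ∷ d ∷ β) y∉cdβ (_ , _ , refl , c∉) =
  ⊥-elim (y∉cdβ (there (here (sym (≢⇒≡ (≢-sym (y∉cdβ ∘ here)) (c∉ ∘ here ∘ sym))))))

β-step : ∀ {α β α'} → ¬ ContainsAll α → IsArch (α ++ β) → HeadUnique (β ++ α') →
  β ≡ βOf (last (α ++ β)) (head (β ++ α')) × ¬ ContainsAll α'
β-step {α} {β} ¬all isArch hu with initLast β
β-step {α} ¬all (all , _) _ | [] = ⊥-elim (¬all (subst ContainsAll (++-identityʳ α) all))
β-step {α} ¬all (_ , v , y , α++β≡ , y∉v) hu | β ∷ʳ′ y'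
  with refl , refl ← ∷ʳ-injective (α ++ β) v (trans (++-assoc α β [ y' ]) α++β≡)
  rewrite sym (++-assoc α β [ y ]) | last-∷ʳ (α ++ β) y = β-shape β (y∉v ∘ Any.++⁺ʳ α) hu

βs-from-modi : ∀ α₀ ps → ¬ ContainsAll α₀ → All IsArch (abArches α₀ ps) → All HeadUnique (abRa ps) →
  map proj₁ ps ≡ zipWith βOf (modusOf (abArches α₀ ps)) (map head (abRa ps))
βs-from-modi α₀ [] _ _ _ = refl
βs-from-modi α₀ ((β , α) ∷ ps) ¬all (isArch ∷ arches) (hu ∷ hus) =
  let β≡ , ¬all′ = β-step ¬all isArch hu in cong₂ _∷_ β≡ (βs-from-modi α ps ¬all′ arches hus)

heads-of-reversed : ∀ (ar : List Word) → map head (map reverse (reverse ar)) ≡ reverse (modusOf ar)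
heads-of-reversed ar = begin
  map head (map reverse (reverse ar))  ≡⟨ map-∘ (reverse ar) ⟨
  map (head ∘ reverse) (reverse ar)    ≡⟨ map-cong head-reverse (reverse ar) ⟩
  map last (reverse ar)                ≡⟨ reverse-map last ar ⟩
  reverse (map last ar)                ∎
  where open ≡-Reasoning

αβ-βs : ∀ {w α₀ ps} → IsABFact w α₀ ps → map proj₁ ps ≡ zipWith βOf (modus w) (reverse (modus (reverse w)))
αβ-βs {w} {α₀} {ps} (_ , fact@(_ , arches , _) , archesᴿ , _ , factᴿ@(_ , archesᴿ-arch , ¬allᴿ) , ra≡ , α₀≡) = begin
  map proj₁ ps                                                 ≡⟨ βs-from-modi α₀ ps ¬all arches hus ⟩
  zipWith βOf (modusOf (abArches α₀ ps)) (map head (abRa ps))  ≡⟨ cong₂ (zipWith βOf) (modusOf-archFact fact) heads ⟩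
  zipWith βOf (modus w) (reverse (modus (reverse w)))          ∎
  where
  open ≡-Reasoning
  ¬all : ¬ ContainsAll α₀
  ¬all = ¬allᴿ ∘ ContainsAll-reverse⁻ ∘ subst ContainsAll (sym α₀≡)
  hus : All HeadUnique (abRa ps)
  hus = subst (All HeadUnique) ra≡ (All.map⁺ (All-reverse⁺ (All.map reverse-arch archesᴿ-arch)))
  heads : map head (abRa ps) ≡ reverse (modus (reverse w))
  heads = begin
    map head (abRa ps)                           ≡⟨ cong (map head) ra≡ ⟨
    map head (map reverse (reverse archesᴿ))     ≡⟨ heads-of-reversed archesᴿ ⟩
    reverse (modusOf archesᴿ)                    ≡⟨ cong reverse (modusOf-archFact factᴿ) ⟩
    reverse (modus (reverse w))                  ∎

lemma5 : (k : ℕ) (w w' : Word) (m : ℕ) →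
    w ∼[ k ] w' → IsIota w m → IsIota w' m → m < k →
    (α₀ α₀' : Word) (ps ps' : List (Word × Word)) →
    IsABFact w α₀ ps → IsABFact w' α₀' ps' →
    ((ar ar' : List Word) (re re' : Word) → ArchFact w ar re → ArchFact w' ar' re' →
       modusOf ar ≡ modusOf ar')
    × (map proj₁ ps ≡ map proj₁ ps')
lemma5 k w w' m w∼w' ιw ιw' m<k α₀ α₀' ps ps' fact fact' =
  (λ ar ar' re re' f f' → trans (modusOf-archFact f) (trans modus≡ (sym (modusOf-archFact f')))) ,
  (begin
    map proj₁ ps                                           ≡⟨ αβ-βs fact ⟩
    zipWith βOf (modus w) (reverse (modus (reverse w)))    ≡⟨ cong₂ (λ μ μᴿ → zipWith βOf μ (reverse μᴿ)) modus≡ modusᴿ≡ ⟩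
    zipWith βOf (modus w') (reverse (modus (reverse w')))  ≡⟨ αβ-βs fact' ⟨
    map proj₁ ps'                                          ∎)
  where
  open ≡-Reasoning
  ι≡ : ι w ≡ m
  ι≡ = sym (isIota⇒≡ι ιw)
  ι'≡ : ι w' ≡ m
  ι'≡ = sym (isIota⇒≡ι ιw')
  modus≡ : modus w ≡ modus w'
  modus≡ = modus-∼ m ι≡ ι'≡ m<k w∼w'
  modusᴿ≡ : modus (reverse w) ≡ modus (reverse w')
  modusᴿ≡ = modus-∼ m (trans (ι-reverse w) ι≡) (trans (ι-reverse w') ι'≡) m<k (∼-reverse w∼w')
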